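{- For $p=2,3$, $P\not\cong E$.
   Context: Let $q=p^f$ with $p$ prime. For $a,b,c\in\mathrm{GF}(q)$ let $t_{a,b,c}$ be the $4\times 4$ matrix over $\mathrm{GF}(q)$ with rows $(1,0,0,0)$, $(-c,1,0,0)$, $(b,0,1,0)$, $(a,b,c,1)$; let $E:=\{t_{a,b,c}\mid a,b,c\in\mathrm{GF}(q)\}$ and $R:=\{t_{a,b,0}\mid a,b\in\mathrm{GF}(q)\}$. For $\alpha\in\mathrm{GF}(q)$ let $\theta_{\alpha}$ be the matrix with rows $(1,0,0,0)$, $(-\alpha,1,0,0)$, $(-\alpha^2,\alpha,1,0)$, $(0,0,\alpha,1)$. Let $\{\alpha_1,\ldots,\alpha_f\}$ be a basis of $\mathrm{GF}(q)$ over $\mathrm{GF}(p)$ and $P:=\langle R,\theta_{\alpha_1},\ldots,\theta_{\alpha_f}\rangle$. -}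

module Defs where

open import Level using (0ℓ)
open import Data.Nat using (ℕ; zero; suc; _^_)
open import Data.Fin using (Fin; toℕ)
open import Data.Fin.Patterns using (0F; 1F; 2F; 3F)
open import Data.Product using (Σ; ∃; ∃-syntax; _×_; _,_)
open import Relation.Binary.PropositionalEquality using (_≡_)
open import Relation.Nullary using (¬_)
open import Algebra.Structures using (IsCommutativeRing)
open import Function.Bundles using (_↔_)

record GF (p f : ℕ) : Set₁ where
  field
    Carrier : Set
    _+_ _*_ : Carrier → Carrier → Carrier
    -_      : Carrier → Carrier
    0# 1#   : Carrier
    isCommutativeRing : IsCommutativeRing _≡_ _+_ _*_ -_ 0# 1#
    0≢1     : ¬ (0# ≡ 1#)
    inverse : ∀ x → ¬ (x ≡ 0#) → ∃[ y ] (x * y ≡ 1#)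
    card    : Carrier ↔ Fin (p ^ f)
  infixl 6 _+_
  infixl 7 _*_

module Matrices {p f : ℕ} (F : GF p f) where
  open GF F

  -- 4×4 matrices, M i j = entry in row i, column j
  Mat : Set
  Mat = Fin 4 → Fin 4 → Carrier

  _≋_ : Mat → Mat → Set
  M ≋ N = ∀ i j → M i j ≡ N i j

  sum4 : (Fin 4 → Carrier) → Carrier
  sum4 v = v 0F + v 1F + v 2F + v 3F

  _·_ : Mat → Mat → Mat
  (M · N) i j = sum4 (λ k → M i k * N k j)

  I : Mat
  I 0F 0F = 1#
  I 1F 1F = 1#
  I 2F 2F = 1#
  I 3F 3F = 1#
  I _  _  = 0#

  fromRows : (Fin 4 → Fin 4 → Carrier) → Mat
  fromRows r = r

  t : Carrier → Carrier → Carrier → Mat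
  t a b c 0F 0F = 1#
  t a b c 1F 0F = - c
  t a b c 1F 1F = 1#
  t a b c 2F 0F = b
  t a b c 2F 2F = 1#
  t a b c 3F 0F = a
  t a b c 3F 1F = b
  t a b c 3F 2F = c
  t a b c 3F 3F = 1#
  t a b c _  _  = 0#

  θ : Carrier → Mat
  θ α 0F 0F = 1#
  θ α 1F 0F = - α
  θ α 1F 1F = 1#
  θ α 2F 0F = - (α * α)
  θ α 2F 1F = α
  θ α 2F 2F = 1#
  θ α 3F 2F = α
  θ α 3F 3F = 1#
  θ α _  _  = 0#

  InE : Mat → Set
  InE M = ∃[ a ] ∃[ b ] ∃[ c ] (M ≋ t a b c)

  InR : Mat → Set
  InR M = ∃[ a ] ∃[ b ] (M ≋ t a b 0#)

  _×ₙ_ : ℕ → Carrier → Carrier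
  zero  ×ₙ x = 0#
  suc n ×ₙ x = x + (n ×ₙ x)

  lincomb : ∀ {n} → (Fin n → Fin p) → (Fin n → Carrier) → Carrier
  lincomb {zero}  c α = 0#
  lincomb {suc n} c α = (toℕ (c Fin.zero) ×ₙ α Fin.zero)
                        + lincomb (λ i → c (Fin.suc i)) (λ i → α (Fin.suc i))

  IsBasis : (Fin f → Carrier) → Set
  IsBasis α = (∀ x → ∃[ c ] (lincomb c α ≡ x))
            × (∀ c c' → lincomb c α ≡ lincomb c' α → ∀ i → c i ≡ c' i)

  data InP (α : Fin f → Carrier) : Mat → Set where
    genR   : ∀ {M} → InR M → InP α M
    genθ   : ∀ i → InP α (θ (α i))
    one    : InP α I
    mul    : ∀ {M N} → InP α M → InP α N → InP α (M · N)
    inv    : ∀ {M N} → InP α M → (M · N) ≋ I → InP α N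
    resp   : ∀ {M N} → InP α M → M ≋ N → InP α N

  record IsoPE (α : Fin f → Carrier) : Set where
    field
      φ      : ∀ M → InP α M → Mat
      φ-E    : ∀ M (m : InP α M) → InE (φ M m)
      φ-resp : ∀ M N (m : InP α M) (n : InP α N) → M ≋ N → φ M m ≋ φ N n
      φ-hom  : ∀ M N (m : InP α M) (n : InP α N) (mn : InP α (M · N))
               → φ (M · N) mn ≋ (φ M m · φ N n)
      φ-inj  : ∀ M N (m : InP α M) (n : InP α N) → φ M m ≋ φ N n → M ≋ N
      φ-surj : ∀ N → InE N → ∃[ M ] Σ (InP α M) (λ m → φ M m ≋ N)

module Submission where

open import Defs
open import Data.Nat using (ℕ; _≥_)
open import Data.Nat.Primality using (Prime)
open import Data.Fin using (Fin)
open import Data.Sum using (_⊎_)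
open import Relation.Binary.PropositionalEquality using (_≡_)
open import Relation.Nullary using (¬_)

open import Level using (0ℓ)
open import Function.Base using (id; _∘_)
open import Function.Bundles using (Inverse; _↔_; mk↔ₛ′)
open import Function.Construct.Composition using (_↔-∘_)
open import Function.Construct.Symmetry using (↔-sym)
open import Function.Properties.Inverse using (↔⇒↣)
open import Data.Nat as ℕ using (zero; suc; _<_)
import Data.Nat.Properties as ℕP
open import Data.Nat.Primality using (prime⇒nonTrivial)
open import Data.Integer as ℤ using (ℤ; -[1+_])
import Data.Integer.Properties as ℤP
open import Data.Sign as Sign using (Sign)
open import Data.Fin using (toℕ; fromℕ<)
open import Data.Fin.Patterns using (0F; 1F; 2F; 3F; 4F; 5F)
import Data.Fin.Properties as FinP
open import Data.Product using (_,_)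
open import Data.Sum using (inj₁; inj₂; [_,_]′)
open import Data.Maybe using (Maybe; just; nothing)
open import Data.Empty using (⊥-elim)
open import Data.Vec using (Vec; _∷_; [])
open import Algebra.Bundles using (CommutativeRing)
open import Algebra.Structures using (IsCommutativeRing)
open import Algebra.Solver.Ring.AlmostCommutativeRing
  using (_-Raw-AlmostCommutative⟶_; fromCommutativeRing)
import Relation.Binary.PropositionalEquality as ≡
open import Relation.Binary.Bundles using (Setoid)
open import Relation.Binary.Definitions using (DecidableEquality)
import Relation.Binary.Reasoning.Setoid as SetoidReasoning
open import Relation.Nullary using (yes; no)
open import Relation.Nullary.Decidable using (via-injection)

-- Idea: E has exponent p, because t_{a,b,c}^k = t_{ka,kb,kc}.  An injective
-- homomorphism P → E transports this to P, so the generator θ_β (β = α_1 ≠ 0)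
-- would satisfy θ_β^(p+1) = θ_β.  But the unipotent θ_β has larger order in
-- small characteristic: the (2,0) entry of θ_β³ is -6β² = 0 ≠ -β² when p = 2,
-- and the (3,0) entry of θ_β⁴ is -10β³ = -β³ ≠ 0 when p = 3.  Hence β = 0,
-- contradicting that basis vectors are nonzero.

module IntegerCoefficients {c ℓ} (R : CommutativeRing c ℓ) where
  open CommutativeRing R
  open import Algebra.Properties.Ring ring
    using (-0#≈0#; -‿involutive; -‿distribˡ-*; -‿distribʳ-*; -‿+-comm)
  open import Algebra.Properties.Semiring.Mult.TCOptimised semiring
    using (_×_; ×-homo-+; ×1-homo-*; 1+×)
  open import Relation.Binary.Reasoning.Setoid setoid

  ⟦_⟧ℤ : ℤ → Carrier
  ⟦ ℤ.+ n    ⟧ℤ = n × 1#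
  ⟦ -[1+ n ] ⟧ℤ = - (suc n × 1#)

  signed : Sign → Carrier → Carrier
  signed Sign.+ x = x
  signed Sign.- x = - x

  signed-cong : ∀ s {x y} → x ≈ y → signed s x ≈ signed s y
  signed-cong Sign.+ x≈y = x≈y
  signed-cong Sign.- x≈y = -‿cong x≈y

  signed-* : ∀ s t x y → signed (s Sign.* t) (x * y) ≈ signed s x * signed t y
  signed-* Sign.+ Sign.+ x y = refl
  signed-* Sign.+ Sign.- x y = -‿distribʳ-* x y
  signed-* Sign.- Sign.+ x y = -‿distribˡ-* x y
  signed-* Sign.- Sign.- x y = begin
    x * y        ≈⟨ -‿involutive (x * y) ⟨
    - - (x * y)  ≈⟨ -‿cong (-‿distribʳ-* x y) ⟩
    - (x * - y)  ≈⟨ -‿distribˡ-* x (- y) ⟩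
    - x * - y    ∎

  ⟦⟧ℤ-signed : ∀ i → ⟦ i ⟧ℤ ≈ signed (ℤ.sign i) (ℤ.∣ i ∣ × 1#)
  ⟦⟧ℤ-signed (ℤ.+ n)  = refl
  ⟦⟧ℤ-signed -[1+ n ] = refl

  ⟦◃⟧ : ∀ s n → ⟦ s ℤ.◃ n ⟧ℤ ≈ signed s (n × 1#)
  ⟦◃⟧ Sign.+ zero    = refl
  ⟦◃⟧ Sign.- zero    = sym -0#≈0#
  ⟦◃⟧ Sign.+ (suc n) = refl
  ⟦◃⟧ Sign.- (suc n) = refl

  1+-cancel : ∀ a b → (1# + a) - (1# + b) ≈ a - b
  1+-cancel a b = begin
    (1# + a) + - (1# + b)    ≈⟨ +-congˡ (-‿+-comm 1# b) ⟨
    (1# + a) + (- 1# + - b)  ≈⟨ +-congʳ (+-comm 1# a) ⟩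
    (a + 1#) + (- 1# + - b)  ≈⟨ +-assoc a 1# _ ⟩
    a + (1# + (- 1# + - b))  ≈⟨ +-congˡ (+-assoc 1# (- 1#) (- b)) ⟨
    a + ((1# - 1#) + - b)    ≈⟨ +-congˡ (+-congʳ (-‿inverseʳ 1#)) ⟩
    a + (0# + - b)           ≈⟨ +-congˡ (+-identityˡ (- b)) ⟩
    a - b                    ∎

  ⊖-homo : ∀ m n → ⟦ m ℤ.⊖ n ⟧ℤ ≈ m × 1# - n × 1#
  ⊖-homo m       zero    = sym (trans (+-congˡ -0#≈0#) (+-identityʳ _))
  ⊖-homo zero    (suc n) = sym (+-identityˡ _)
  ⊖-homo (suc m) (suc n) = begin
    ⟦ suc m ℤ.⊖ suc n ⟧ℤ           ≡⟨ ≡.cong ⟦_⟧ℤ (ℤP.[1+m]⊖[1+n]≡m⊖n m n) ⟩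
    ⟦ m ℤ.⊖ n ⟧ℤ                    ≈⟨ ⊖-homo m n ⟩
    m × 1# - n × 1#                 ≈⟨ 1+-cancel _ _ ⟨
    (1# + m × 1#) - (1# + n × 1#)   ≈⟨ +-cong (1+× m 1#) (-‿cong (1+× n 1#)) ⟨
    suc m × 1# - suc n × 1#         ∎

  +-homo : ∀ i j → ⟦ i ℤ.+ j ⟧ℤ ≈ ⟦ i ⟧ℤ + ⟦ j ⟧ℤ
  +-homo (ℤ.+ m)  (ℤ.+ n)  = ×-homo-+ 1# m n
  +-homo (ℤ.+ m)  -[1+ n ] = ⊖-homo m (suc n)
  +-homo -[1+ m ] (ℤ.+ n)  = trans (⊖-homo n (suc m)) (+-comm _ _)
  +-homo -[1+ m ] -[1+ n ] = begin
    - (suc (suc (m ℕ.+ n)) × 1#)       ≡⟨ ≡.cong (λ k → - (k × 1#)) (ℕP.+-suc (suc m) n) ⟨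
    - ((suc m ℕ.+ suc n) × 1#)         ≈⟨ -‿cong (×-homo-+ 1# (suc m) (suc n)) ⟩
    - (suc m × 1# + suc n × 1#)        ≈⟨ -‿+-comm _ _ ⟨
    - (suc m × 1#) + - (suc n × 1#)    ∎

  *-homo : ∀ i j → ⟦ i ℤ.* j ⟧ℤ ≈ ⟦ i ⟧ℤ * ⟦ j ⟧ℤ
  *-homo i j = begin
    ⟦ i ℤ.* j ⟧ℤ                           ≈⟨ ⟦◃⟧ (s Sign.* t) (m ℕ.* n) ⟩
    signed (s Sign.* t) ((m ℕ.* n) × 1#)    ≈⟨ signed-cong (s Sign.* t) (×1-homo-* m n) ⟩
    signed (s Sign.* t) ((m × 1#) * (n × 1#)) ≈⟨ signed-* s t _ _ ⟩
    signed s (m × 1#) * signed t (n × 1#)   ≈⟨ *-cong (⟦⟧ℤ-signed i) (⟦⟧ℤ-signed j) ⟨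
    ⟦ i ⟧ℤ * ⟦ j ⟧ℤ                        ∎
    where s = ℤ.sign i; t = ℤ.sign j; m = ℤ.∣ i ∣; n = ℤ.∣ j ∣

  -‿homo : ∀ i → ⟦ ℤ.- i ⟧ℤ ≈ - ⟦ i ⟧ℤ
  -‿homo (ℤ.+ zero)    = sym -0#≈0#
  -‿homo (ℤ.+ (suc n)) = refl
  -‿homo -[1+ n ]      = sym (-‿involutive _)

  ℤ→R : ℤ.+-*-rawRing -Raw-AlmostCommutative⟶ fromCommutativeRing R
  ℤ→R = record
    { ⟦_⟧ = ⟦_⟧ℤ ; +-homo = +-homo ; *-homo = *-homo ; -‿homo = -‿homo
    ; 0-homo = refl ; 1-homo = refl }

  coefficient≟ : ∀ i j → Maybe (⟦ i ⟧ℤ ≈ ⟦ j ⟧ℤ)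
  coefficient≟ i j with i ℤ.≟ j
  ... | yes i≡j = just (reflexive (≡.cong ⟦_⟧ℤ i≡j))
  ... | no  _   = nothing

  open import Algebra.Solver.Ring ℤ.+-*-rawRing (fromCommutativeRing R) ℤ→R coefficient≟
    public using (Polynomial; con; var; _:+_; _:*_; :-_; _:-_; _:^_; _:=_; ⟦_⟧; ⟦_⟧↓; prove; solve)

module FieldFacts {p f} (F : GF p f) where
  open GF F
  open ≡ using (refl; sym; trans; cong)
  open ≡.≡-Reasoning

  ring : CommutativeRing 0ℓ 0ℓ
  ring = record { isCommutativeRing = isCommutativeRing }

  open CommutativeRing ring using (*-identityˡ; +-identityʳ; zeroʳ; semiring; +-commutativeMonoid)
  open import Algebra.Properties.Ring (CommutativeRing.ring ring) using (+-identityʳ-unique)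
  open import Algebra.Properties.Semiring.Mult.TCOptimised semiring
    public using (_×_)
  open import Algebra.Properties.Semiring.Mult.TCOptimised semiring using (×1-homo-*; ×ᵤ≈×; 1+×)
  open import Algebra.Properties.CommutativeMonoid.Sum +-commutativeMonoid
    using (sum; sum-permute; sum-cong-≗; ∑-distrib-+; sum-replicate)
  open import Algebra.Properties.Semiring.Exp semiring public using (_^_)
  open IntegerCoefficients ring public

  _≟_ : DecidableEquality Carrier
  _≟_ = via-injection (↔⇒↣ card) FinP._≟_

  no-zero-divisors : ∀ x y → x * y ≡ 0# → x ≡ 0# ⊎ y ≡ 0#
  no-zero-divisors x y xy≡0 with x ≟ 0#
  ... | yes x≡0 = inj₁ x≡0
  ... | no  x≢0 with inverse x x≢0
  ...   | x⁻¹ , xx⁻¹≡1 = inj₂ (begin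
    y                ≡⟨ *-identityˡ y ⟨
    1# * y           ≡⟨ cong (_* y) xx⁻¹≡1 ⟨
    (x * x⁻¹) * y    ≡⟨ solve 3 (λ x x⁻¹ y → (x :* x⁻¹) :* y := x⁻¹ :* (x :* y)) refl x x⁻¹ y ⟩
    x⁻¹ * (x * y)    ≡⟨ cong (x⁻¹ *_) xy≡0 ⟩
    x⁻¹ * 0#         ≡⟨ zeroʳ x⁻¹ ⟩
    0#               ∎)

  ^-zero : ∀ x n → x ^ n ≡ 0# → x ≡ 0#
  ^-zero x zero    1≡0  = ⊥-elim (0≢1 (sym 1≡0))
  ^-zero x (suc n) xxⁿ≡0 = [ id , ^-zero x n ]′ (no-zero-divisors x (x ^ n) xxⁿ≡0)

  ×1-homo-^ : ∀ m k → (m ℕ.^ k) × 1# ≡ (m × 1#) ^ k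
  ×1-homo-^ m zero    = refl
  ×1-homo-^ m (suc k) = trans (×1-homo-* m (m ℕ.^ k)) (cong ((m × 1#) *_) (×1-homo-^ m k))

  translation : Carrier ↔ Carrier
  translation = mk↔ₛ′ (_+ 1#) (_+ - 1#)
    (solve 1 (λ x → x :- con (ℤ.+ 1) :+ con (ℤ.+ 1) := x) refl)
    (solve 1 (λ x → x :+ con (ℤ.+ 1) :- con (ℤ.+ 1) := x) refl)

  -- In a ring with n elements, n · 1 = 0: translating by 1 permutes the ring,
  -- so Σ x = Σ (x + 1) = Σ x + n · 1.
  card-annihilates : ∀ {n} → Carrier ↔ Fin n → n × 1# ≡ 0#
  card-annihilates {n} e = +-identityʳ-unique S (n × 1#) (sym S≡S+n)
    where
    open Inverse e using (to; from; strictlyInverseʳ)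
    S = sum from
    S≡S+n : S ≡ S + n × 1#
    S≡S+n = begin
      S                                    ≡⟨ sum-permute from (e ↔-∘ (translation ↔-∘ ↔-sym e)) ⟩
      sum (λ i → from (to (from i + 1#)))  ≡⟨ sum-cong-≗ (λ i → strictlyInverseʳ (from i + 1#)) ⟩
      sum (λ i → from i + 1#)              ≡⟨ ∑-distrib-+ from (λ _ → 1#) ⟩
      S + sum {n} (λ _ → 1#)               ≡⟨ cong (S +_) (trans (sum-replicate n {1#}) (×ᵤ≈× n 1#)) ⟩
      S + n × 1#                           ∎

  characteristic : p × 1# ≡ 0#
  characteristic = ^-zero (p × 1#) f (trans (sym (×1-homo-^ p f)) (card-annihilates card))

  suc-p≡1 : suc p × 1# ≡ 1#
  suc-p≡1 = trans (1+× p 1#) (trans (cong (1# +_) characteristic) (+-identityʳ 1#))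

cases₄ : ∀ {a} {P : Fin 4 → Set a} → P 0F → P 1F → P 2F → P 3F → ∀ i → P i
cases₄ p₀ p₁ p₂ p₃ 0F = p₀
cases₄ p₀ p₁ p₂ p₃ 1F = p₁
cases₄ p₀ p₁ p₂ p₃ 2F = p₂
cases₄ p₀ p₁ p₂ p₃ 3F = p₃

module MatrixFacts {p f} (F : GF p f) where
  open GF F
  open Matrices F
  open FieldFacts F
  open CommutativeRing ring using (*-identityˡ; +-identityʳ; zeroˡ)
  open import Algebra.Properties.Ring (CommutativeRing.ring ring) using (-0#≈0#; -‿injective)
  open ≡ using (refl; sym; trans; cong; cong₂)

  ≋-refl : ∀ {M} → M ≋ M
  ≋-refl i j = refl

  ≋-sym : ∀ {M N} → M ≋ N → N ≋ M
  ≋-sym M≋N i j = sym (M≋N i j)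

  ≋-trans : ∀ {M N O} → M ≋ N → N ≋ O → M ≋ O
  ≋-trans M≋N N≋O i j = trans (M≋N i j) (N≋O i j)

  ≋-setoid : Setoid 0ℓ 0ℓ
  ≋-setoid = record { Carrier = Mat ; _≈_ = _≋_
                    ; isEquivalence = record { refl = ≋-refl ; sym = ≋-sym ; trans = ≋-trans } }

  module ≋-Reasoning = SetoidReasoning ≋-setoid

  ·-cong : ∀ {M M′ N N′} → M ≋ M′ → N ≋ N′ → (M · N) ≋ (M′ · N′)
  ·-cong {M} {M′} {N} {N′} M≋M′ N≋N′ i j =
    cong₂ _+_ (cong₂ _+_ (cong₂ _+_ (term 0F) (term 1F)) (term 2F)) (term 3F)
    where
    term : ∀ k → M i k * N k j ≡ M′ i k * N′ k j
    term k = cong₂ _*_ (M≋M′ i k) (N≋N′ k j)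

  -- M ^⁺ n = M ^ (n + 1).  Positive powers avoid the identity matrix, which an
  -- abstract isomorphism is not assumed to preserve.
  _^⁺_ : Mat → ℕ → Mat
  M ^⁺ zero  = M
  M ^⁺ suc n = (M ^⁺ n) · M

  ^⁺-cong : ∀ {M N} n → M ≋ N → (M ^⁺ n) ≋ (N ^⁺ n)
  ^⁺-cong zero    M≋N = M≋N
  ^⁺-cong (suc n) M≋N = ·-cong (^⁺-cong n M≋N) M≋N

  -- 4 × 4 matrices of polynomials in n variables; the evaluation of the
  -- formal product ⊙ is by definition the product · of the evaluations.
  PolyMat : ℕ → Set
  PolyMat n = Fin 4 → Fin 4 → Polynomial n

  _⊙_ : ∀ {n} → PolyMat n → PolyMat n → PolyMat n
  (A ⊙ B) i j = A i 0F :* B 0F j :+ A i 1F :* B 1F j :+ A i 2F :* B 2F j :+ A i 3F :* B 3F j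

  evalᴹ : ∀ {n} → PolyMat n → Vec Carrier n → Mat
  evalᴹ A ρ i j = ⟦ A i j ⟧ ρ

  by-normal-forms : ∀ {n} (A B : PolyMat n) ρ → (∀ i j → ⟦ A i j ⟧↓ ρ ≡ ⟦ B i j ⟧↓ ρ)
                  → evalᴹ A ρ ≋ evalᴹ B ρ
  by-normal-forms A B ρ nf i j = prove ρ (A i j) (B i j) (nf i j)

  tᴾ : ∀ {n} → Polynomial n → Polynomial n → Polynomial n → PolyMat n
  tᴾ x y z 0F 0F = con (ℤ.+ 1)
  tᴾ x y z 1F 0F = :- z
  tᴾ x y z 1F 1F = con (ℤ.+ 1)
  tᴾ x y z 2F 0F = y
  tᴾ x y z 2F 2F = con (ℤ.+ 1)
  tᴾ x y z 3F 0F = x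
  tᴾ x y z 3F 1F = y
  tᴾ x y z 3F 2F = z
  tᴾ x y z 3F 3F = con (ℤ.+ 1)
  tᴾ x y z _  _  = con (ℤ.+ 0)

  eval-tᴾ : ∀ {n} x y z (ρ : Vec Carrier n) → evalᴹ (tᴾ x y z) ρ ≋ t (⟦ x ⟧ ρ) (⟦ y ⟧ ρ) (⟦ z ⟧ ρ)
  eval-tᴾ x y z ρ = cases₄ (cases₄ refl refl refl refl) (cases₄ refl refl refl refl)
                           (cases₄ refl refl refl refl) (cases₄ refl refl refl refl)

  t-cong : ∀ {a a′ b b′ c c′} → a ≡ a′ → b ≡ b′ → c ≡ c′ → t a b c ≋ t a′ b′ c′
  t-cong refl refl refl = ≋-refl

  t-mul : ∀ a b c a′ b′ c′ →
          (t a b c · t a′ b′ c′) ≋ t (a + a′ + (c * b′ + - (b * c′))) (b + b′) (c + c′)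
  t-mul a b c a′ b′ c′ = begin
    t a b c · t a′ b′ c′              ≈⟨ ·-cong (eval-tᴾ x y z ρ) (eval-tᴾ x′ y′ z′ ρ) ⟨
    evalᴹ (tᴾ x y z ⊙ tᴾ x′ y′ z′) ρ  ≈⟨ by-normal-forms (tᴾ x y z ⊙ tᴾ x′ y′ z′) product ρ normal-forms ⟩
    evalᴹ product ρ                   ≈⟨ eval-tᴾ (x :+ x′ :+ (z :* y′ :- y :* z′)) (y :+ y′) (z :+ z′) ρ ⟩
    t (a + a′ + (c * b′ + - (b * c′))) (b + b′) (c + c′) ∎
    where
    open ≋-Reasoning
    ρ = a ∷ b ∷ c ∷ a′ ∷ b′ ∷ c′ ∷ []
    x y z x′ y′ z′ : Polynomial 6
    x = var 0F; y = var 1F; z = var 2F; x′ = var 3F; y′ = var 4F; z′ = var 5F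
    product : PolyMat 6
    product = tᴾ (x :+ x′ :+ (z :* y′ :- y :* z′)) (y :+ y′) (z :+ z′)
    normal-forms : ∀ i j → ⟦ (tᴾ x y z ⊙ tᴾ x′ y′ z′) i j ⟧↓ ρ ≡ ⟦ product i j ⟧↓ ρ
    normal-forms = cases₄ (cases₄ refl refl refl refl) (cases₄ refl refl refl refl)
                          (cases₄ refl refl refl refl) (cases₄ refl refl refl refl)

  t-^⁺ : ∀ a b c n → let k = suc n × 1# in (t a b c ^⁺ n) ≋ t (k * a) (k * b) (k * c)
  t-^⁺ a b c zero    = t-cong (sym (*-identityˡ a)) (sym (*-identityˡ b)) (sym (*-identityˡ c))
  t-^⁺ a b c (suc n) = begin
    (t a b c ^⁺ n) · t a b c                 ≈⟨ ·-cong (t-^⁺ a b c n) (≋-refl {t a b c}) ⟩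
    t (k * a) (k * b) (k * c) · t a b c      ≈⟨ t-mul (k * a) (k * b) (k * c) a b c ⟩
    t (k * a + a + (k * c * b + - (k * b * c))) (k * b + b) (k * c + c)
      ≈⟨ t-cong (solve 4 (λ k a b c → k :* a :+ a :+ (k :* c :* b :- k :* b :* c)
                                       := (k :+ con (ℤ.+ 1)) :* a) refl k a b c)
                (solve 2 (λ k b → k :* b :+ b := (k :+ con (ℤ.+ 1)) :* b) refl k b)
                (solve 2 (λ k c → k :* c :+ c := (k :+ con (ℤ.+ 1)) :* c) refl k c) ⟩
    t ((k + 1#) * a) ((k + 1#) * b) ((k + 1#) * c) ∎
    where
    open ≋-Reasoning
    k = suc n × 1#

  E-period : ∀ a b c → (t a b c ^⁺ p) ≋ t a b c
  E-period a b c = ≋-trans (t-^⁺ a b c p) (t-cong (p+1-acts-trivially a) (p+1-acts-trivially b) (p+1-acts-trivially c))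
    where
    p+1-acts-trivially : ∀ x → (suc p × 1#) * x ≡ x
    p+1-acts-trivially x = trans (cong (_* x) suc-p≡1) (*-identityˡ x)

  θᴾ : ∀ {n} → Polynomial n → PolyMat n
  θᴾ x 0F 0F = con (ℤ.+ 1)
  θᴾ x 1F 0F = :- x
  θᴾ x 1F 1F = con (ℤ.+ 1)
  θᴾ x 2F 0F = :- (x :* x)
  θᴾ x 2F 1F = x
  θᴾ x 2F 2F = con (ℤ.+ 1)
  θᴾ x 3F 2F = x
  θᴾ x 3F 3F = con (ℤ.+ 1)
  θᴾ x _  _  = con (ℤ.+ 0)

  θ³-entry : ∀ β → (θ β ^⁺ 2) 2F 0F ≡ (2 × 1#) * - ((3 × 1#) * β ^ 2)
  θ³-entry β = prove (β ∷ []) (((Θ ⊙ Θ) ⊙ Θ) 2F 0F) (con (ℤ.+ 2) :* :- (con (ℤ.+ 3) :* var 0F :^ 2)) refl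
    where Θ = θᴾ (var 0F)

  θ⁴-entry : ∀ β → (θ β ^⁺ 3) 3F 0F ≡ - (β ^ 3) + (3 × 1#) * - ((3 × 1#) * β ^ 3)
  θ⁴-entry β = prove (β ∷ []) ((((Θ ⊙ Θ) ⊙ Θ) ⊙ Θ) 3F 0F)
                     (:- var 0F :^ 3 :+ con (ℤ.+ 3) :* :- (con (ℤ.+ 3) :* var 0F :^ 3)) refl
    where Θ = θᴾ (var 0F)

  θ³≋θ⇒β²≡0 : 2 × 1# ≡ 0# → ∀ β → (θ β ^⁺ 2) ≋ θ β → β ^ 2 ≡ 0#
  θ³≋θ⇒β²≡0 char2 β period = -‿injective (begin
    - (β ^ 2)              ≡⟨ solve 1 (λ x → :- (x :^ 2) := :- (x :* x)) refl β ⟩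
    θ β 2F 0F              ≡⟨ period 2F 0F ⟨
    (θ β ^⁺ 2) 2F 0F       ≡⟨ θ³-entry β ⟩
    (2 × 1#) * X           ≡⟨ cong (_* X) char2 ⟩
    0# * X                 ≡⟨ zeroˡ X ⟩
    0#                     ≡⟨ -0#≈0# ⟨
    - 0#                   ∎)
    where
    open ≡.≡-Reasoning
    X = - ((3 × 1#) * β ^ 2)

  θ⁴≋θ⇒β³≡0 : 3 × 1# ≡ 0# → ∀ β → (θ β ^⁺ 3) ≋ θ β → β ^ 3 ≡ 0#
  θ⁴≋θ⇒β³≡0 char3 β period = -‿injective (begin
    - (β ^ 3)                  ≡⟨ +-identityʳ _ ⟨
    - (β ^ 3) + 0#             ≡⟨ cong (- (β ^ 3) +_) (zeroˡ X) ⟨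
    - (β ^ 3) + 0# * X         ≡⟨ cong (λ k → - (β ^ 3) + k * X) char3 ⟨
    - (β ^ 3) + (3 × 1#) * X   ≡⟨ θ⁴-entry β ⟨
    (θ β ^⁺ 3) 3F 0F           ≡⟨ period 3F 0F ⟩
    0#                         ≡⟨ -0#≈0# ⟨
    - 0#                       ∎)
    where
    open ≡.≡-Reasoning
    X = - ((3 × 1#) * β ^ 3)

  θ-period⇒β≡0 : p ≡ 2 ⊎ p ≡ 3 → ∀ β → (θ β ^⁺ p) ≋ θ β → β ≡ 0#
  θ-period⇒β≡0 (inj₁ p≡2) β period =
    ^-zero β 2 (θ³≋θ⇒β²≡0 (≡.subst (λ q → q × 1# ≡ 0#) p≡2 characteristic) β
                          (≡.subst (λ q → (θ β ^⁺ q) ≋ θ β) p≡2 period))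
  θ-period⇒β≡0 (inj₂ p≡3) β period =
    ^-zero β 3 (θ⁴≋θ⇒β³≡0 (≡.subst (λ q → q × 1# ≡ 0#) p≡3 characteristic) β
                          (≡.subst (λ q → (θ β ^⁺ q) ≋ θ β) p≡3 period))

module PeriodTransfer {p f} (F : GF p f) (α : Fin f → GF.Carrier F) (iso : Matrices.IsoPE F α) where
  open Matrices F
  open MatrixFacts F
  open IsoPE iso

  ^⁺-closed : ∀ {M} → InP α M → ∀ n → InP α (M ^⁺ n)
  ^⁺-closed m zero    = m
  ^⁺-closed m (suc n) = mul (^⁺-closed m n) m

  φ-^⁺ : ∀ {M} (m : InP α M) n → φ (M ^⁺ n) (^⁺-closed m n) ≋ (φ M m ^⁺ n)
  φ-^⁺     m zero    = ≋-refl
  φ-^⁺ {M} m (suc n) = ≋-trans (φ-hom (M ^⁺ n) M (^⁺-closed m n) m (^⁺-closed m (suc n)))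
                               (·-cong (φ-^⁺ m n) (≋-refl {φ M m}))

  P-period : ∀ {M} → InP α M → (M ^⁺ p) ≋ M
  P-period {M} m with φ-E M m
  ... | a , b , c , φM≋t = φ-inj (M ^⁺ p) M (^⁺-closed m p) m (begin
    φ (M ^⁺ p) (^⁺-closed m p)  ≈⟨ φ-^⁺ m p ⟩
    φ M m ^⁺ p                  ≈⟨ ^⁺-cong p φM≋t ⟩
    t a b c ^⁺ p                ≈⟨ E-period a b c ⟩
    t a b c                     ≈⟨ φM≋t ⟨
    φ M m                       ∎)
    where open ≋-Reasoning

module BasisFacts {p f} (F : GF p f) where
  open GF F
  open Matrices F
  open ≡ using (refl; sym; trans; cong; cong₂)
  open IsCommutativeRing isCommutativeRing using (+-identityˡ; +-identityʳ)

  lincomb-vanishes : ∀ {n} (c : Fin n → Fin p) (γ : Fin n → Carrier)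
                   → (∀ i → toℕ (c i) ×ₙ γ i ≡ 0#) → lincomb c γ ≡ 0#
  lincomb-vanishes {zero}  c γ terms = refl
  lincomb-vanishes {suc n} c γ terms =
    trans (cong₂ _+_ (terms 0F) (lincomb-vanishes (c ∘ Fin.suc) (γ ∘ Fin.suc) (terms ∘ Fin.suc)))
          (+-identityˡ 0#)

  -- if the prime field has two distinct elements, no basis vector is zero:
  -- otherwise the unit coefficient vector at i and the zero vector would
  -- both represent 0
  basis-nonzero : 1 < p → (α : Fin f → Carrier) → IsBasis α → ∀ i → ¬ α i ≡ 0#
  basis-nonzero 1<p α (_ , unique) i αᵢ≡0 = ℕP.1+n≢0 (begin
    1                 ≡⟨ δᵢ≡1 ⟨
    toℕ (δ i)         ≡⟨ cong toℕ (unique δ (λ _ → 0ₚ) both-zero i) ⟩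
    toℕ 0ₚ            ≡⟨ FinP.toℕ-fromℕ< 0<p ⟩
    0                 ∎)
    where
    open ≡.≡-Reasoning
    0<p : 0 < p
    0<p = ℕP.<-trans (ℕ.s≤s ℕ.z≤n) 1<p
    0ₚ 1ₚ : Fin p
    0ₚ = fromℕ< 0<p
    1ₚ = fromℕ< 1<p
    δ : Fin f → Fin p
    δ j with i FinP.≟ j
    ... | yes _ = 1ₚ
    ... | no  _ = 0ₚ
    δᵢ≡1 : toℕ (δ i) ≡ 1
    δᵢ≡1 with i FinP.≟ i
    ... | yes _   = FinP.toℕ-fromℕ< 1<p
    ... | no  i≢i = ⊥-elim (i≢i refl)
    δ-terms : ∀ j → toℕ (δ j) ×ₙ α j ≡ 0#
    δ-terms j with i FinP.≟ j
    ... | yes refl rewrite FinP.toℕ-fromℕ< 1<p = trans (+-identityʳ (α i)) αᵢ≡0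
    ... | no  _    rewrite FinP.toℕ-fromℕ< 0<p = refl
    0-terms : ∀ j → toℕ 0ₚ ×ₙ α j ≡ 0#
    0-terms j rewrite FinP.toℕ-fromℕ< 0<p = refl
    both-zero : lincomb δ α ≡ lincomb (λ _ → 0ₚ) α
    both-zero = trans (lincomb-vanishes δ α δ-terms) (sym (lincomb-vanishes (λ _ → 0ₚ) α 0-terms))

corollary3p10 : (p f : ℕ) → Prime p → (p ≡ 2 ⊎ p ≡ 3) → f ≥ 1
    → (F : GF p f) → (α : Fin f → GF.Carrier F) → Matrices.IsBasis F α
    → ¬ Matrices.IsoPE F α
corollary3p10 p (suc f) p-prime p≡2⊎p≡3 (ℕ.s≤s ℕ.z≤n) F α basis iso =
  basis-nonzero 1<p α basis 0F (θ-period⇒β≡0 p≡2⊎p≡3 (α 0F) θ-period)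
  where
  open Matrices F using (θ; _≋_; genθ)
  open BasisFacts F
  open MatrixFacts F
  open PeriodTransfer F α iso
  1<p : 1 < p
  1<p = ℕ.nonTrivial⇒n>1 p {{prime⇒nonTrivial p-prime}}
  θ-period : (θ (α 0F) ^⁺ p) ≋ θ (α 0F)
  θ-period = P-period (genθ 0F)
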